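{- Let $N\ge2$, $k\ge 1$ and $m\ge 0$ be integers with $N>km$, and let $G_1,\dots,G_k$ be impartial games with $\mathbf O_m\notin o(G_j)$ for every $j=1,\dots,k$. Then $\mathbf O_{km}\notin o(G_1+\cdots+G_k)$.
   Context: All games are short impartial games (identified with the finite set of their options, no infinite runs); $+$ is the disjunctive sum. There are $N$ players moving cyclically; under normal play the player unable to move on their turn is the unique loser. Relative to a position, the players are $\mathbf N=\mathbf O_0$ (next to move), $\mathbf O_1,\dots,\mathbf O_{N-2}$, $\mathbf P=\mathbf O_{N-1}$, where $\mathbf O_i$ moves $i$ turns after $\mathbf N$. The outcome $o(G)\subseteq\{\mathbf O_0,\dots,\mathbf O_{N-1}\}$ is defined recursively: $\mathbf N\in o(G)$ iff some option $G'$ has $\mathbf P\in o(G')$; for $1\le i\le N-1$, $\mathbf O_i\in o(G)$ iff every option $G'$ has $\mathbf O_{i-1}\in o(G')$. -}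

module Defs where

open import Data.Nat using (ℕ; zero; suc; _∸_)
open import Data.Fin using (Fin; zero; suc)
open import Data.List using (List; []; _∷_; _++_)
open import Data.Product using (_×_)
open import Data.Sum using (_⊎_)
open import Data.Empty using (⊥)
open import Data.Unit using (⊤)
open import Function using (_∘_)

-- A short impartial game, identified with the finite list of its options.
-- (Being an inductive type, every run is finite.)
data Game : Set where
  mk : List Game → Game

options : Game → List Game
options (mk gs) = gs

mutual
  _⊕_ : Game → Game → Game
  mk gs ⊕ mk hs = mk (lefts gs (mk hs) ++ rights (mk gs) hs)

  lefts : List Game → Game → List Game
  lefts []       h = []
  lefts (g ∷ gs) h = (g ⊕ h) ∷ lefts gs h

  rights : Game → List Game → List Game
  rights g []       = []
  rights g (h ∷ hs) = (g ⊕ h) ∷ rights g hs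

-- Outcome membership for N players:  InO N i G  means  O_i ∈ o(G).
-- (Meaningful for i < N; P = O_{N-1}.)
--   O_0 ∈ o(G)      iff some option G' has O_{N-1} ∈ o(G')
--   O_{i+1} ∈ o(G)  iff every option G' has O_i ∈ o(G')
mutual
  InO : ℕ → ℕ → Game → Set
  InO N zero    (mk gs) = SomeO N (N ∸ 1) gs
  InO N (suc i) (mk gs) = EveryO N i gs

  SomeO : ℕ → ℕ → List Game → Set
  SomeO N i []       = ⊥
  SomeO N i (g ∷ gs) = InO N i g ⊎ SomeO N i gs

  EveryO : ℕ → ℕ → List Game → Set
  EveryO N i []       = ⊤
  EveryO N i (g ∷ gs) = InO N i g × EveryO N i gs

-- G_0 + G_1 + ... + G_{k-1}  (right-nested), for k ≥ 1.
-- The k = 0 case (empty sum = the zero game) is never used by the theorem.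
sumGames : (k : ℕ) → (Fin k → Game) → Game
sumGames zero          G = mk []
sumGames (suc zero)    G = G zero
sumGames (suc (suc k)) G = G zero ⊕ sumGames (suc k) (G ∘ suc)

module Submission where

-- The heart of the proof is a two-game statement:
--   if a + b < N, O_a ∉ o(G) and O_b ∉ o(H), then O_{a+b} ∉ o(G + H).
-- It is proved by induction on the pair (G , H) (moves in either summand)
-- with a case split on the index:
--   * a = b = 0: every move G' + H or G + H' of the sum must avoid P; this is
--     the statement again for (N-1) + 0 resp. 0 + (N-1);
--   * a = a'+1: all options of G + H have O_{a'+b}; for each option G' of G,
--     O_{a'} ∉ o(G') would give O_{a'+b} ∉ o(G' + H) by induction, so (outcome
--     membership being decidable) every G' has O_{a'}, i.e. O_a ∈ o(G);
--   * a = 0, b = b'+1: symmetric, through the options of H.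
-- The theorem for k summands follows by induction on k, peeling off G_1.

open import Defs
open import Data.Nat using (ℕ; _*_; _≤_; _<_)
open import Data.Fin using (Fin)
open import Relation.Nullary using (¬_)

open import Data.Nat using (zero; suc; _+_; _∸_; z<s)
open import Data.Nat.Properties using (+-identityʳ; m≤n+m; ≤-<-trans; <⇒≤; ∸-monoʳ-<)
open import Data.Fin using (zero; suc)
open import Data.List using (List; []; _∷_; _++_; map)
open import Data.List.Relation.Unary.Any using (Any; here; there)
open import Data.List.Relation.Unary.All using (All; []; _∷_)
import Data.List.Relation.Unary.Any.Properties as Any
import Data.List.Relation.Unary.All as All
import Data.List.Relation.Unary.All.Properties as All
open import Data.Product using (_×_; _,_)
open import Data.Sum using (inj₁; inj₂)
open import Data.Unit using (tt)
open import Relation.Nullary using (Dec; yes; no)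
open import Relation.Nullary.Decidable using (_⊎-dec_; _×-dec_; decidable-stable)
open import Relation.Binary.PropositionalEquality using (_≡_; refl; cong₂; subst; sym)
open import Function using (_∘_)

mutual
  game-ind : (P : Game → Set) → (∀ gs → All P gs → P (mk gs)) → ∀ G → P G
  game-ind P step (mk gs) = step gs (game-ind-all P step gs)

  game-ind-all : (P : Game → Set) → (∀ gs → All P gs → P (mk gs)) → ∀ gs → All P gs
  game-ind-all P step []       = []
  game-ind-all P step (g ∷ gs) = game-ind P step g ∷ game-ind-all P step gs

lefts-map : ∀ gs H → lefts gs H ≡ map (_⊕ H) gs
lefts-map []       H = refl
lefts-map (g ∷ gs) H = cong₂ _∷_ refl (lefts-map gs H)

rights-map : ∀ G hs → rights G hs ≡ map (G ⊕_) hs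
rights-map G []       = refl
rights-map G (h ∷ hs) = cong₂ _∷_ refl (rights-map G hs)

options-⊕ : ∀ gs hs → options (mk gs ⊕ mk hs) ≡ map (_⊕ mk hs) gs ++ map (mk gs ⊕_) hs
options-⊕ gs hs = cong₂ _++_ (lefts-map gs (mk hs)) (rights-map (mk gs) hs)

module _ (N : ℕ) where

  -- Outcome membership is decidable (games are finite trees); this is what
  -- lets the proof pass from "not every option lacks O_i" to "every option has O_i".
  mutual
    decInO : ∀ i G → Dec (InO N i G)
    decInO zero    (mk gs) = decSomeO (N ∸ 1) gs
    decInO (suc i) (mk gs) = decEveryO i gs

    decSomeO : ∀ i gs → Dec (SomeO N i gs)
    decSomeO i []       = no λ ()
    decSomeO i (g ∷ gs) = decInO i g ⊎-dec decSomeO i gs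

    decEveryO : ∀ i gs → Dec (EveryO N i gs)
    decEveryO i []       = yes tt
    decEveryO i (g ∷ gs) = decInO i g ×-dec decEveryO i gs

  recoverO : ∀ i G s H → (¬ InO N i G → ¬ InO N s H) → InO N s H → InO N i G
  recoverO i G s H refute inH = decidable-stable (decInO i G) (λ notG → refute notG inH)

  someO⇒any : ∀ {i} gs → SomeO N i gs → Any (InO N i) gs
  someO⇒any (g ∷ gs) (inj₁ p) = here p
  someO⇒any (g ∷ gs) (inj₂ p) = there (someO⇒any gs p)

  any⇒someO : ∀ {i gs} → Any (InO N i) gs → SomeO N i gs
  any⇒someO (here p)  = inj₁ p
  any⇒someO (there p) = inj₂ (any⇒someO p)

  everyO⇒all : ∀ {i} gs → EveryO N i gs → All (InO N i) gs
  everyO⇒all []       tt       = []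
  everyO⇒all (g ∷ gs) (p , ps) = p ∷ everyO⇒all gs ps

  all⇒everyO : ∀ {i gs} → All (InO N i) gs → EveryO N i gs
  all⇒everyO []       = tt
  all⇒everyO (p ∷ ps) = p , all⇒everyO ps

  InO-zero⇒Any : ∀ G → InO N 0 G → Any (InO N (N ∸ 1)) (options G)
  InO-zero⇒Any (mk gs) = someO⇒any gs

  ¬InO-zero⇒All : ∀ G → ¬ InO N 0 G → All (¬_ ∘ InO N (N ∸ 1)) (options G)
  ¬InO-zero⇒All (mk gs) notG = All.¬Any⇒All¬ gs (notG ∘ any⇒someO)

  InO-suc⇒All : ∀ {i} G → InO N (suc i) G → All (InO N i) (options G)
  InO-suc⇒All (mk gs) = everyO⇒all gs

  All⇒InO-suc : ∀ {i} G → All (InO N i) (options G) → InO N (suc i) G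
  All⇒InO-suc (mk gs) = all⇒everyO

  Additive : Game → Game → Set
  Additive G H = ∀ a b → a + b < N → ¬ InO N a G → ¬ InO N b H → ¬ InO N (a + b) (G ⊕ H)

  last<N : 0 < N → N ∸ 1 < N
  last<N = ∸-monoʳ-< z<s

  module _ (gs hs : List Game)
           (ihL : All (λ g → Additive g (mk hs)) gs) (ihR : All (Additive (mk gs)) hs) where

    -- Case a = b = 0: N has no winning move in G + H, since every move
    -- G' + H (resp. G + H') avoids P by the claim for (N-1) + 0 (resp. 0 + (N-1)).
    additive-zero : 0 < N → ¬ InO N 0 (mk gs) → ¬ InO N 0 (mk hs) → ¬ InO N 0 (mk gs ⊕ mk hs)
    additive-zero 0<N notG notH inSum with Any.++⁻ (map (_⊕ mk hs) gs) winningMove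
      where
        winningMove : Any (InO N (N ∸ 1)) (map (_⊕ mk hs) gs ++ map (mk gs ⊕_) hs)
        winningMove = subst (Any _) (options-⊕ gs hs) (InO-zero⇒Any (mk gs ⊕ mk hs) inSum)
    ... | inj₁ leftMove  = All.All¬⇒¬Any (All.zipWith leftStuck (ihL , ¬InO-zero⇒All (mk gs) notG))
                                         (Any.map⁻ leftMove)
      where
        leftStuck : ∀ {g} → Additive g (mk hs) × ¬ InO N (N ∸ 1) g → ¬ InO N (N ∸ 1) (g ⊕ mk hs)
        leftStuck {g} (ih , notG') = subst (λ s → ¬ InO N s (g ⊕ mk hs)) (+-identityʳ (N ∸ 1))
          (ih (N ∸ 1) 0 (subst (_< N) (sym (+-identityʳ (N ∸ 1))) (last<N 0<N)) notG' notH)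
    ... | inj₂ rightMove = All.All¬⇒¬Any (All.zipWith rightStuck (ihR , ¬InO-zero⇒All (mk hs) notH))
                                         (Any.map⁻ rightMove)
      where
        rightStuck : ∀ {h} → Additive (mk gs) h × ¬ InO N (N ∸ 1) h → ¬ InO N (N ∸ 1) (mk gs ⊕ h)
        rightStuck (ih , notH') = ih 0 (N ∸ 1) (last<N 0<N) notG notH'

    -- Case a = a'+1: all moves G' + H have O_{a'+b}, hence every G' has O_{a'}.
    additive-left : ∀ a b → suc a + b < N → ¬ InO N (suc a) (mk gs) → ¬ InO N b (mk hs) →
                    ¬ InO N (suc a + b) (mk gs ⊕ mk hs)
    additive-left a b a+b<N notG notH inSum =
      notG (All⇒InO-suc (mk gs) (All.zipWith leftHas (ihL , All.map⁻ (All.++⁻ˡ _ allMoves))))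
      where
        allMoves : All (InO N (a + b)) (map (_⊕ mk hs) gs ++ map (mk gs ⊕_) hs)
        allMoves = subst (All _) (options-⊕ gs hs) (InO-suc⇒All (mk gs ⊕ mk hs) inSum)

        leftHas : ∀ {g} → Additive g (mk hs) × InO N (a + b) (g ⊕ mk hs) → InO N a g
        leftHas {g} (ih , inMove) =
          recoverO a g (a + b) (g ⊕ mk hs) (λ notG' → ih a b (<⇒≤ a+b<N) notG' notH) inMove

    -- Case a = 0, b = b'+1: all moves G + H' have O_{b'}, hence every H' has O_{b'}.
    additive-right : ∀ b → suc b < N → ¬ InO N 0 (mk gs) → ¬ InO N (suc b) (mk hs) →
                     ¬ InO N (suc b) (mk gs ⊕ mk hs)
    additive-right b b<N notG notH inSum =
      notH (All⇒InO-suc (mk hs) (All.zipWith rightHas (ihR , All.map⁻ (All.++⁻ʳ _ allMoves))))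
      where
        allMoves : All (InO N b) (map (_⊕ mk hs) gs ++ map (mk gs ⊕_) hs)
        allMoves = subst (All _) (options-⊕ gs hs) (InO-suc⇒All (mk gs ⊕ mk hs) inSum)

        rightHas : ∀ {h} → Additive (mk gs) h × InO N b (mk gs ⊕ h) → InO N b h
        rightHas {h} (ih , inMove) =
          recoverO b h b (mk gs ⊕ h) (λ notH' → ih 0 b (<⇒≤ b<N) notG notH') inMove

    additive-step : Additive (mk gs) (mk hs)
    additive-step zero    zero    = additive-zero
    additive-step (suc a) b       = additive-left a b
    additive-step zero    (suc b) = additive-right b

  additive : ∀ G H → Additive G H
  additive = game-ind (λ G → ∀ H → Additive G H) λ gs ihL →
    game-ind (Additive (mk gs)) λ hs ihR → additive-step gs hs (All.map (λ ih → ih (mk hs)) ihL) ihR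

mainTheorem6 : (N k m : ℕ) → 2 ≤ N → 1 ≤ k → k * m < N →
    (G : Fin k → Game) → (∀ j → ¬ InO N m (G j)) →
    ¬ InO N (k * m) (sumGames k G)
-- Induction on k: G_1 + ... + G_k = G_1 + (G_2 + ... + G_k), k·m = m + (k-1)·m.
mainTheorem6 N zero          m _   ()  _  G avoid
mainTheorem6 N (suc zero)    m _   _   _  G avoid =
  subst (λ s → ¬ InO N s (G zero)) (sym (+-identityʳ m)) (avoid zero)
mainTheorem6 N (suc (suc k)) m 2≤N _ km<N G avoid =
  additive N (G zero) (sumGames (suc k) (G ∘ suc)) m (suc k * m) km<N (avoid zero)
    (mainTheorem6 N (suc k) m 2≤N z<s (≤-<-trans (m≤n+m (suc k * m) m) km<N) (G ∘ suc) (avoid ∘ suc))
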